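{- Let $G=(V,E)$ be a finite undirected graph with nonnegative edge weights, let $\lambda(G)$ be the weight of a global minimum cut of $G$, and let $\rho\ge 1$. Let $A_\rho(G)$ be the set of all cuts $X$ (i.e. sets $\emptyset\neq X\subsetneq V$, with $X$ and $V\setminus X$ regarded as the same cut) satisfying $w(X)\le \rho\,\lambda(G)$. Suppose $X,Y\in A_\rho(G)$ cross each other, i.e. $X\cap Y\neq\emptyset$, $X\setminus Y\neq\emptyset$, $Y\setminus X\neq\emptyset$ and $V\setminus (X\cup Y)\neq\emptyset$. Then at least two of the four cuts $Z_1=X\cap Y$, $Z_2=X\setminus Y$, $Z_3=Y\setminus X$, $Z_4=V\setminus(X\cup Y)$ belong to $A_\rho(G)$.
   Context: A cut of $G$ is given by a vertex set $\emptyset\neq X\subsetneq V$; its weight $w(X)$ is the sum of the weights of the edges having one endpoint in $X$ and the other in $V\setminus X$. The global minimum cut weight $\lambda(G)$ is the minimum of $w(X)$ over all cuts. A cut $X$ is $\rho$-approximate if $w(X)\le\rho\lambda(G)$, and $A_\rho(G)$ (the $\rho$-approximation set) is the set of all $\rho$-approximate cuts. The cuts $Z_1,Z_2,Z_3,Z_4$ are called the composed cuts of $X$ and $Y$.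
   Formalization: The edge weights and the parameter ρ are taken in the rationals, so the minimum cut weight λ(G) is rational as well. -}

module Defs where

open import Data.Nat using (ℕ)
open import Data.Bool using (Bool; true; false)
open import Data.Fin using (Fin)
open import Data.Fin.Subset using (Subset; _∈_; _∉_; ∁; _∩_; _∪_; _─_; Nonempty)
open import Data.Vec using (lookup)
open import Data.List using (List; foldr; map)
open import Data.List using () renaming (allFin to allFinL)
open import Data.Rational using (ℚ; 0ℚ; _+_; _*_; _≤_)
open import Data.Product using (_×_; Σ; ∃; ∃-syntax)
open import Relation.Binary.PropositionalEquality using (_≡_; _≢_)

-- A finite undirected graph on vertex set Fin n with nonnegative edge
-- weights: a symmetric weight function (w i j = weight of edge {i,j},
-- 0 meaning "no edge"; parallel edges are merged by adding weights).
record WGraph (n : ℕ) : Set where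
  field
    weight    : Fin n → Fin n → ℚ
    nonneg    : ∀ i j → 0ℚ ≤ weight i j
    symmetric : ∀ i j → weight i j ≡ weight j i

open WGraph public

Σv : {n : ℕ} → (Fin n → ℚ) → ℚ
Σv {n} f = foldr _+_ 0ℚ (map f (allFinL n))

crossing : {n : ℕ} → WGraph n → Subset n → Fin n → Fin n → ℚ
crossing G X i j with lookup X i | lookup X j
... | true  | false = weight G i j
... | _     | _     = 0ℚ

cutWeight : {n : ℕ} → WGraph n → Subset n → ℚ
cutWeight G X = Σv (λ i → Σv (λ j → crossing G X i j))

IsCut : {n : ℕ} → Subset n → Set
IsCut X = Nonempty X × Nonempty (∁ X)

IsMinCutWeight : {n : ℕ} → WGraph n → ℚ → Set
IsMinCutWeight G λ' =
  (∃[ X ] (IsCut X × cutWeight G X ≡ λ')) ×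
  (∀ X → IsCut X → λ' ≤ cutWeight G X)

InApprox : {n : ℕ} → WGraph n → ℚ → ℚ → Subset n → Set
InApprox G ρ lam X = IsCut X × cutWeight G X ≤ ρ * lam

Cross : {n : ℕ} → Subset n → Subset n → Set
Cross X Y = Nonempty (X ∩ Y) × Nonempty (X ─ Y) × Nonempty (Y ─ X) × Nonempty (∁ (X ∪ Y))

composed : {n : ℕ} → Subset n → Subset n → Fin 4 → Subset n
composed X Y Fin.zero = X ∩ Y
composed X Y (Fin.suc Fin.zero) = X ─ Y
composed X Y (Fin.suc (Fin.suc Fin.zero)) = Y ─ X
composed X Y (Fin.suc (Fin.suc (Fin.suc Fin.zero))) = ∁ (X ∪ Y)

-- The cut function w is symmetric and submodular, whence both
--   w(X ∩ Y) + w(V ∖ (X ∪ Y)) ≤ w X + w Y   and   w(X ∖ Y) + w(Y ∖ X) ≤ w X + w Y.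
-- Both follow edge by edge: 2 w(Z) counts the ordered pairs (i, j) separated by Z with weight
-- w i j, and a pair is separated by at most as many sets on the left as on the right (a
-- check on the four Booleans i ∈ X, i ∈ Y, j ∈ X, j ∈ Y). As w X, w Y ≤ ρ λ, one cut of each
-- of the pairs {Z₁, Z₄} and {Z₂, Z₃} is ρ-approximate, and crossing makes every Zₖ a cut.
module Submission where

open import Defs
open import Data.Nat using (ℕ)
open import Data.Fin using (Fin)
open import Data.Fin.Subset using (Subset)
open import Data.Rational using (ℚ; 1ℚ; _≤_)
open import Data.Product using (_×_; ∃-syntax)
open import Relation.Binary.PropositionalEquality using (_≢_)

open import Data.Bool using (Bool; true; false; _∧_; _∨_; not; _xor_; T)
open import Data.Bool.Properties using (∧-conicalˡ; ∧-conicalʳ; ∧-zeroʳ; ∧-identityʳ; not-injective; T-∧)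
open import Data.Fin using (zero; suc; opposite)
open import Data.Fin.Patterns using (0F; 1F; 2F; 3F)
open import Data.Fin.Subset using (_∈_; ∁; _∩_; _∪_; _─_; Nonempty)
open import Data.Fin.Subset.Properties using (x∈p∩q⁻)
import Data.List as List
open import Data.List.Properties using (map-tabulate)
import Data.Nat as ℕ
open import Data.Nat.Properties using (≤ᵇ⇒≤)
open import Data.Product using (_,_; proj₁; proj₂)
open import Data.Rational using (0ℚ; _+_)
open import Data.Rational.Properties
  using (≤-refl; ≤-trans; _≤?_; ≰⇒>; <-irrefl; <-≤-trans; +-mono-≤; +-mono-<; +-monoʳ-≤; +-comm;
         +-0-monoid; +-0-commutativeMonoid; module ≤-Reasoning)
import Data.Sum as Sum
open import Data.Sum using (_⊎_; inj₁; inj₂)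
open import Data.Vec using (_∷_; lookup)
open import Data.Vec.Properties using (lookup-map; lookup-zipWith; lookup⇒[]=; []=⇒lookup)
open import Data.Vec.Functional using (Vector)
open import Function using (_∘_; Equivalence)
open import Relation.Binary.PropositionalEquality using (_≡_; refl; sym; trans; cong; cong₂; module ≡-Reasoning)
open import Relation.Nullary using (yes; no; contradiction)

open import Algebra.Bundles using (CommutativeMonoid)
open import Algebra.Properties.CommutativeMonoid.Sum +-0-commutativeMonoid
  using (sum; sum-syntax; ∑-distrib-+; ∑-comm; sum-cong-≗)
open import Algebra.Properties.Monoid.Mult +-0-monoid
  using (×-homo-+) renaming (_×_ to _·_)
open import Algebra.Properties.CommutativeSemigroup
  (CommutativeMonoid.commutativeSemigroup +-0-commutativeMonoid) using (interchange)

Σv≡∑ : ∀ {n} (f : Vector ℚ n) → Σv f ≡ ∑[ i < n ] f i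
Σv≡∑ f = trans (cong (List.foldr _+_ 0ℚ) (map-tabulate (λ i → i) f)) (foldr-tabulate f)
  where
  foldr-tabulate : ∀ {m} (g : Vector ℚ m) → List.foldr _+_ 0ℚ (List.tabulate g) ≡ sum g
  foldr-tabulate {ℕ.zero} g = refl
  foldr-tabulate {ℕ.suc m} g = cong (g zero +_) (foldr-tabulate (g ∘ suc))

∑-mono-≤ : ∀ {n} {f g : Vector ℚ n} → (∀ i → f i ≤ g i) → sum f ≤ sum g
∑-mono-≤ {ℕ.zero} f≤g = ≤-refl
∑-mono-≤ {ℕ.suc n} f≤g = +-mono-≤ (f≤g zero) (∑-mono-≤ (f≤g ∘ suc))

∑∑-distrib-+ : ∀ {m n} (f g : Fin m → Fin n → ℚ) →
  ∑[ i < m ] ∑[ j < n ] (f i j + g i j) ≡ ∑[ i < m ] ∑[ j < n ] f i j + ∑[ i < m ] ∑[ j < n ] g i j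
∑∑-distrib-+ {m} {n} f g =
  trans (sum-cong-≗ {m} (λ i → ∑-distrib-+ (f i) (g i))) (∑-distrib-+ (λ i → ∑[ j < n ] f i j) (λ i → ∑[ j < n ] g i j))

x+x≤y+y⇒x≤y : ∀ {x y} → x + x ≤ y + y → x ≤ y
x+x≤y+y⇒x≤y {x} {y} x+x≤y+y with x ≤? y
... | yes x≤y = x≤y
... | no  x≰y = contradiction (<-≤-trans (+-mono-< y<x y<x) x+x≤y+y) (<-irrefl refl)
  where y<x = ≰⇒> x≰y

a+b≤c+d⇒a≤r⊎b≤r : ∀ {a b c d r} → a + b ≤ c + d → c ≤ r → d ≤ r → a ≤ r ⊎ b ≤ r
a+b≤c+d⇒a≤r⊎b≤r {a} {b} {r = r} a+b≤c+d c≤r d≤r with a ≤? r | b ≤? r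
... | yes a≤r | _       = inj₁ a≤r
... | no  _   | yes b≤r = inj₂ b≤r
... | no  a≰r | no  b≰r =
  contradiction (<-≤-trans (+-mono-< (≰⇒> a≰r) (≰⇒> b≰r)) (≤-trans a+b≤c+d (+-mono-≤ c≤r d≤r))) (<-irrefl refl)

𝟙 : Bool → ℕ
𝟙 true  = 1
𝟙 false = 0

·-nonneg : ∀ {w} → 0ℚ ≤ w → ∀ n → 0ℚ ≤ n · w
·-nonneg 0≤w ℕ.zero    = ≤-refl
·-nonneg 0≤w (ℕ.suc n) = +-mono-≤ 0≤w (·-nonneg 0≤w n)

·-monoˡ-≤ : ∀ {w} → 0ℚ ≤ w → ∀ {m n} → m ℕ.≤ n → m · w ≤ n · w
·-monoˡ-≤ 0≤w {n = n} ℕ.z≤n = ·-nonneg 0≤w n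
·-monoˡ-≤ {w} 0≤w (ℕ.s≤s m≤n) = +-monoʳ-≤ w (·-monoˡ-≤ 0≤w m≤n)

every : (Bool → Bool) → Bool
every f = f true ∧ f false

every-sound : ∀ f → T (every f) → ∀ b → T (f b)
every-sound f h true  = proj₁ (Equivalence.to T-∧ h)
every-sound f h false = proj₂ (Equivalence.to T-∧ h)

every⁴-sound : (f : Bool → Bool → Bool → Bool → Bool) →
  T (every λ a → every λ b → every λ c → every λ d → f a b c d) → ∀ a b c d → T (f a b c d)
every⁴-sound f h a b c d =
  every-sound (f a b c) (every-sound (λ c → every (f a b c))
    (every-sound (λ b → every λ c → every (f a b c))
      (every-sound (λ a → every λ b → every λ c → every (f a b c)) h a) b) c) d

separates : ∀ {n} → Subset n → Fin n → Fin n → Bool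
separates Z i j = lookup Z i xor lookup Z j

module _ {n : ℕ} (G : WGraph n) where

  crossing-symmetrised : ∀ Z i j →
    crossing G Z i j + crossing G Z j i ≡ 𝟙 (separates Z i j) · weight G i j
  crossing-symmetrised Z i j with lookup Z i | lookup Z j
  ... | true  | true  = refl
  ... | true  | false = refl
  ... | false | true  = trans (+-comm 0ℚ (weight G j i)) (cong (_+ 0ℚ) (symmetric G j i))
  ... | false | false = refl

  cutWeight-doubled : ∀ Z →
    cutWeight G Z + cutWeight G Z ≡ ∑[ i < n ] ∑[ j < n ] (𝟙 (separates Z i j) · weight G i j)
  cutWeight-doubled Z = begin
    cutWeight G Z + cutWeight G Z                     ≡⟨ cong₂ _+_ cutWeight≡∑∑ cutWeight≡∑∑ ⟩
    ∑[ i < n ] ∑[ j < n ] c i j + ∑[ i < n ] ∑[ j < n ] c i j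
                                                      ≡⟨ cong (∑[ i < n ] ∑[ j < n ] c i j +_) (∑-comm c) ⟩
    ∑[ i < n ] ∑[ j < n ] c i j + ∑[ i < n ] ∑[ j < n ] c j i
                                                      ≡⟨ sym (∑∑-distrib-+ c (λ i j → c j i)) ⟩
    ∑[ i < n ] ∑[ j < n ] (c i j + c j i)             ≡⟨ sum-cong-≗ {n} (λ i → sum-cong-≗ {n} (crossing-symmetrised Z i)) ⟩
    ∑[ i < n ] ∑[ j < n ] (𝟙 (separates Z i j) · weight G i j) ∎
    where
    open ≡-Reasoning
    c : Fin n → Fin n → ℚ
    c = crossing G Z
    cutWeight≡∑∑ : cutWeight G Z ≡ ∑[ i < n ] ∑[ j < n ] c i j
    cutWeight≡∑∑ = trans (Σv≡∑ (λ i → Σv (c i))) (sum-cong-≗ {n} (λ i → Σv≡∑ (c i)))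

  cutWeight-pair-doubled : ∀ A B →
    (cutWeight G A + cutWeight G B) + (cutWeight G A + cutWeight G B)
      ≡ ∑[ i < n ] ∑[ j < n ] ((𝟙 (separates A i j) ℕ.+ 𝟙 (separates B i j)) · weight G i j)
  cutWeight-pair-doubled A B = begin
    (wA + wB) + (wA + wB)             ≡⟨ interchange wA wB wA wB ⟩
    (wA + wA) + (wB + wB)             ≡⟨ cong₂ _+_ (cutWeight-doubled A) (cutWeight-doubled B) ⟩
    ∑[ i < n ] ∑[ j < n ] s A i j + ∑[ i < n ] ∑[ j < n ] s B i j
                                      ≡⟨ sym (∑∑-distrib-+ (s A) (s B)) ⟩
    ∑[ i < n ] ∑[ j < n ] (s A i j + s B i j)
                                      ≡⟨ sum-cong-≗ {n} (λ i → sum-cong-≗ {n} (λ j →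
                                           sym (×-homo-+ (weight G i j) (𝟙 (separates A i j)) (𝟙 (separates B i j))))) ⟩
    ∑[ i < n ] ∑[ j < n ] ((𝟙 (separates A i j) ℕ.+ 𝟙 (separates B i j)) · weight G i j) ∎
    where
    open ≡-Reasoning
    wA = cutWeight G A
    wB = cutWeight G B
    s : Subset n → Fin n → Fin n → ℚ
    s Z i j = 𝟙 (separates Z i j) · weight G i j

  cutWeight-+-mono-≤ : ∀ A B C D →
    (∀ i j → 𝟙 (separates A i j) ℕ.+ 𝟙 (separates B i j) ℕ.≤ 𝟙 (separates C i j) ℕ.+ 𝟙 (separates D i j)) →
    cutWeight G A + cutWeight G B ≤ cutWeight G C + cutWeight G D
  cutWeight-+-mono-≤ A B C D counts≤ = x+x≤y+y⇒x≤y (begin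
    (cutWeight G A + cutWeight G B) + (cutWeight G A + cutWeight G B)
      ≡⟨ cutWeight-pair-doubled A B ⟩
    ∑[ i < n ] ∑[ j < n ] ((𝟙 (separates A i j) ℕ.+ 𝟙 (separates B i j)) · weight G i j)
      ≤⟨ ∑-mono-≤ (λ i → ∑-mono-≤ (λ j → ·-monoˡ-≤ (nonneg G i j) (counts≤ i j))) ⟩
    ∑[ i < n ] ∑[ j < n ] ((𝟙 (separates C i j) ℕ.+ 𝟙 (separates D i j)) · weight G i j)
      ≡⟨ cutWeight-pair-doubled C D ⟨
    (cutWeight G C + cutWeight G D) + (cutWeight G C + cutWeight G D) ∎)
    where open ≤-Reasoning

part : Fin 4 → Bool → Bool → Bool
part 0F a b = a ∧ b
part 1F a b = a ∧ not b
part 2F a b = b ∧ not a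
part 3F a b = not (a ∨ b)

lookup-─ : ∀ {n} (X Y : Subset n) i → lookup (X ─ Y) i ≡ lookup X i ∧ not (lookup Y i)
lookup-─ (x ∷ X) (true  ∷ Y) zero    = sym (∧-zeroʳ x)
lookup-─ (x ∷ X) (false ∷ Y) zero    = sym (∧-identityʳ x)
lookup-─ (_ ∷ X) (_     ∷ Y) (suc i) = lookup-─ X Y i

lookup-composed : ∀ {n} (X Y : Subset n) k i → lookup (composed X Y k) i ≡ part k (lookup X i) (lookup Y i)
lookup-composed X Y 0F i = lookup-zipWith _∧_ i X Y
lookup-composed X Y 1F i = lookup-─ X Y i
lookup-composed X Y 2F i = lookup-─ Y X i
lookup-composed X Y 3F i = trans (lookup-map i not (X ∪ Y)) (cong not (lookup-zipWith _∨_ i X Y))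

-- opposite pairs the composed cuts as {X ∩ Y, V ∖ (X ∪ Y)} and {X ∖ Y, Y ∖ X}.
parts-separation-≤ : ∀ k a b c d →
  𝟙 (part k a b xor part k c d) ℕ.+ 𝟙 (part (opposite k) a b xor part (opposite k) c d)
    ℕ.≤ 𝟙 (a xor c) ℕ.+ 𝟙 (b xor d)
parts-separation-≤ k a b c d = ≤ᵇ⇒≤ _ _ (every⁴-sound (check k) (checked k) a b c d)
  where
  check : Fin 4 → Bool → Bool → Bool → Bool → Bool
  check k a b c d = 𝟙 (part k a b xor part k c d) ℕ.+ 𝟙 (part (opposite k) a b xor part (opposite k) c d)
                      ℕ.≤ᵇ 𝟙 (a xor c) ℕ.+ 𝟙 (b xor d)
  -- for fixed k the type is a closed Boolean test that evaluates to T true = ⊤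
  checked : ∀ k → T (every λ a → every λ b → every λ c → every λ d → check k a b c d)
  checked 0F = _
  checked 1F = _
  checked 2F = _
  checked 3F = _

cutWeight-composed-opposite : ∀ {n} (G : WGraph n) (X Y : Subset n) k →
  cutWeight G (composed X Y k) + cutWeight G (composed X Y (opposite k)) ≤ cutWeight G X + cutWeight G Y
cutWeight-composed-opposite G X Y k =
  cutWeight-+-mono-≤ G (composed X Y k) (composed X Y (opposite k)) X Y counts≤
  where
  counts≤ : ∀ i j →
    𝟙 (lookup (composed X Y k) i xor lookup (composed X Y k) j)
      ℕ.+ 𝟙 (lookup (composed X Y (opposite k)) i xor lookup (composed X Y (opposite k)) j)
      ℕ.≤ 𝟙 (separates X i j) ℕ.+ 𝟙 (separates Y i j)
  counts≤ i j
    rewrite lookup-composed X Y k i | lookup-composed X Y k j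
          | lookup-composed X Y (opposite k) i | lookup-composed X Y (opposite k) j
    = parts-separation-≤ k (lookup X i) (lookup Y i) (lookup X j) (lookup Y j)

∈∁-by-lookup : ∀ {n} {Z : Subset n} {x} → lookup Z x ≡ false → x ∈ ∁ Z
∈∁-by-lookup {Z = Z} {x} Zx≡false = lookup⇒[]= x (∁ Z) (trans (lookup-map x not Z) (cong not Zx≡false))

composed-isCut : ∀ {n} {X Y : Subset n} → Cross X Y → ∀ k → IsCut (composed X Y k)
composed-isCut {X = X} {Y} (z₀@(p , p∈X∩Y) , z₁@(q , q∈X─Y) , z₂ , z₃) k = nonempty k , co-nonempty k
  where
  nonempty : ∀ k → Nonempty (composed X Y k)
  nonempty 0F = z₀
  nonempty 1F = z₁
  nonempty 2F = z₂
  nonempty 3F = z₃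

  Xp : lookup X p ≡ true
  Xp = []=⇒lookup (proj₁ (x∈p∩q⁻ X Y p∈X∩Y))
  Yp : lookup Y p ≡ true
  Yp = []=⇒lookup (proj₂ (x∈p∩q⁻ X Y p∈X∩Y))
  Xq∧¬Yq : lookup X q ∧ not (lookup Y q) ≡ true
  Xq∧¬Yq = trans (sym (lookup-─ X Y q)) ([]=⇒lookup q∈X─Y)
  Xq : lookup X q ≡ true
  Xq = ∧-conicalˡ _ _ Xq∧¬Yq
  Yq : lookup Y q ≡ false
  Yq = not-injective (∧-conicalʳ _ _ Xq∧¬Yq)

  outside : ∀ {x a b} k → lookup X x ≡ a → lookup Y x ≡ b → part k a b ≡ false → x ∈ ∁ (composed X Y k)
  outside k refl refl partₖ≡false = ∈∁-by-lookup (trans (lookup-composed X Y k _) partₖ≡false)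

  co-nonempty : ∀ k → Nonempty (∁ (composed X Y k))
  co-nonempty 0F = q , outside 0F Xq Yq refl
  co-nonempty 1F = p , outside 1F Xp Yp refl
  co-nonempty 2F = p , outside 2F Xp Yp refl
  co-nonempty 3F = p , outside 3F Xp Yp refl

theorem1 : {n : ℕ} (G : WGraph n) (ρ lam : ℚ) → 1ℚ ≤ ρ → IsMinCutWeight G lam →
    (X Y : Subset n) → InApprox G ρ lam X → InApprox G ρ lam Y → Cross X Y →
    ∃[ i ] ∃[ j ] (i ≢ j × InApprox G ρ lam (composed X Y i) × InApprox G ρ lam (composed X Y j))
theorem1 G ρ lam _ _ X Y (_ , wX≤) (_ , wY≤) cross = two-of (one-of 0F) (one-of 1F)
  where
  Good : Fin 4 → Set
  Good k = InApprox G ρ lam (composed X Y k)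

  one-of : ∀ k → Good k ⊎ Good (opposite k)
  one-of k = Sum.map (composed-isCut cross k ,_) (composed-isCut cross (opposite k) ,_)
    (a+b≤c+d⇒a≤r⊎b≤r (cutWeight-composed-opposite G X Y k) wX≤ wY≤)

  two-of : Good 0F ⊎ Good 3F → Good 1F ⊎ Good 2F → ∃[ i ] ∃[ j ] (i ≢ j × Good i × Good j)
  two-of (inj₁ g₀) (inj₁ g₁) = 0F , 1F , (λ ()) , g₀ , g₁
  two-of (inj₁ g₀) (inj₂ g₂) = 0F , 2F , (λ ()) , g₀ , g₂
  two-of (inj₂ g₃) (inj₁ g₁) = 3F , 1F , (λ ()) , g₃ , g₁
  two-of (inj₂ g₃) (inj₂ g₂) = 3F , 2F , (λ ()) , g₃ , g₂
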